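{- Consider the following six identities in the language of residuated binars (with $\cdot$, $\backslash$, $\slash$, $\wedge$, $\vee$ as described in the context), each understood as universally quantified over $x,y,z$: (D1) $x\cdot(y\wedge z)= (x\cdot y)\wedge(x\cdot z)$; (D2) $(x\wedge y)\cdot z= (x\cdot z)\wedge (y\cdot z)$; (D3) $x\backslash (y\vee z) = (x\backslash y)\vee(x\backslash z)$; (D4) $(x\vee y)\slash z = (x\slash z)\vee(y\slash z)$; (D5) $(x\wedge y)\backslash z = (x\backslash z)\vee(y\backslash z)$; (D6) $x\slash (y\wedge z) = (x\slash y)\vee(x\slash z)$. Then, over the class of all residuated binars (with no lattice-distributivity assumption), none of these identities follows from any combination of the others. Equivalently, for each $i\in\{1,\dots,6\}$ there exists a residuated binar that satisfies all five identities (D$j$) with $j\neq i$ but fails to satisfy (D$i$).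
   Context: A residuated binar is an algebra $\mathbf{A}=(A,\wedge,\vee,\cdot,\backslash,\slash)$ with five binary operations such that $(A,\wedge,\vee)$ is a lattice (not necessarily distributive), with lattice order $\leq$, $\cdot$ is an arbitrary binary operation on $A$, and for all $x,y,z\in A$: $x\cdot y\leq z \iff y\leq x\backslash z \iff x\leq z\slash y$. -}

module Defs where

open import Level using (0ℓ)
open import Data.Product using (_×_)
open import Data.Fin using (Fin)
open import Relation.Nullary using (¬_)
open import Relation.Binary.PropositionalEquality using (_≡_)
open import Function.Bundles using (_⇔_)
open import Algebra.Core using (Op₂)
open import Algebra.Lattice.Structures using (IsLattice)

record ResiduatedBinar : Set₁ where
  infixl 7 _·_
  infixr 6 _∧_
  infixr 5 _∨_
  infix 4 _≤_
  field
    Carrier : Set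
    _∧_ _∨_ _·_ _\\_ _//_ : Op₂ Carrier
    isLattice : IsLattice (_≡_ {A = Carrier}) _∨_ _∧_

  _≤_ : Carrier → Carrier → Set
  x ≤ y = (x ∧ y) ≡ x

  field
    resˡ : ∀ x y z → ((x · y) ≤ z) ⇔ (y ≤ (x \\ z))
    resʳ : ∀ x y z → ((x · y) ≤ z) ⇔ (x ≤ (z // y))

module _ (A : ResiduatedBinar) where
  open ResiduatedBinar A

  D1 D2 D3 D4 D5 D6 : Set
  D1 = ∀ x y z → x · (y ∧ z) ≡ (x · y) ∧ (x · z)
  D2 = ∀ x y z → (x ∧ y) · z ≡ (x · z) ∧ (y · z)
  D3 = ∀ x y z → x \\ (y ∨ z) ≡ (x \\ y) ∨ (x \\ z)
  D4 = ∀ x y z → (x ∨ y) // z ≡ (x // z) ∨ (y // z)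
  D5 = ∀ x y z → (x ∧ y) \\ z ≡ (x \\ z) ∨ (y \\ z)
  D6 = ∀ x y z → x // (y ∧ z) ≡ (x // y) ∨ (x // z)

-- D i A : the i-th identity (i = 0,…,5 stands for D1,…,D6)
D : Fin 6 → ResiduatedBinar → Set
D Fin.zero = D1
D (Fin.suc Fin.zero) = D2
D (Fin.suc (Fin.suc Fin.zero)) = D3
D (Fin.suc (Fin.suc (Fin.suc Fin.zero))) = D4
D (Fin.suc (Fin.suc (Fin.suc (Fin.suc Fin.zero)))) = D5
D (Fin.suc (Fin.suc (Fin.suc (Fin.suc (Fin.suc Fin.zero))))) = D6

-- A failure of implication among identities is witnessed by a finite model, and for a
-- residuated binar given by operation tables on Fin n the lattice laws, both residuation
-- laws and the six identities are decided by exhaustive evaluation.  The opposite binar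
-- (x ∘ y = y · x, with the two residuals exchanged) turns D1, D3, D5 into D2, D4, D6
-- and back, so three models, on 7, 7 and 14 elements, separating D1, D3 and D5 suffice.
module Submission where

open import Defs
open import Data.Fin using (Fin; zero; suc)
open import Data.Product using (Σ; _×_)
open import Relation.Nullary using (¬_)
open import Relation.Binary.PropositionalEquality using (_≡_)

open import Agda.Builtin.FromNat using (Number; fromNat)
open import Algebra.Core using (Op₂)
open import Algebra.Lattice.Structures using (IsLattice)
import Data.Fin.Literals as Fin
import Data.Fin.Properties as Fin
import Data.Nat.Literals as ℕ
open import Data.Nat using (ℕ)
open import Data.Product using (_,_)
open import Data.Unit using (⊤; tt)
open import Data.Vec using (Vec; lookup; _∷_; [])
open import Function using (flip; _∘_)
open import Function.Bundles using (_⇔_; mk⇔; Equivalence)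
open import Relation.Binary.Definitions using (DecidableEquality)
open import Relation.Binary.PropositionalEquality
  using (refl; sym; trans; cong; cong₂; isEquivalence)
open import Relation.Nullary.Decidable
  using (Dec; True; map′; toWitness; from-yes; ¬?; _×-dec_; _→-dec_)
open import Relation.Unary using (Decidable)

instance
  ℕ-number : Number ℕ
  ℕ-number = ℕ.number

  Fin-number : ∀ {n} → Number (Fin n)
  Fin-number {n} = Fin.number n

  ⊤-instance : ⊤
  ⊤-instance = tt

IndependenceWitness : Fin 6 → ResiduatedBinar → Set
IndependenceWitness i A = ((j : Fin 6) → ¬ (j ≡ i) → D j A) × ¬ D i A

_ᵒᵖ : ResiduatedBinar → ResiduatedBinar
A ᵒᵖ = record
  { Carrier = Carrier ; _∧_ = _∧_ ; _∨_ = _∨_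
  ; _·_ = flip _·_ ; _\\_ = flip _//_ ; _//_ = flip _\\_
  ; isLattice = isLattice
  ; resˡ = λ x y z → resʳ y x z
  ; resʳ = λ x y z → resˡ y x z
  }
  where open ResiduatedBinar A

mirror : Fin 6 → Fin 6
mirror zero                               = suc zero
mirror (suc zero)                         = zero
mirror (suc (suc zero))                   = suc (suc (suc zero))
mirror (suc (suc (suc zero)))             = suc (suc zero)
mirror (suc (suc (suc (suc zero))))       = suc (suc (suc (suc (suc zero))))
mirror (suc (suc (suc (suc (suc zero))))) = suc (suc (suc (suc zero)))

mirror-involutive : ∀ i → mirror (mirror i) ≡ i
mirror-involutive zero                               = refl
mirror-involutive (suc zero)                         = refl
mirror-involutive (suc (suc zero))                   = refl
mirror-involutive (suc (suc (suc zero)))             = refl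
mirror-involutive (suc (suc (suc (suc zero))))       = refl
mirror-involutive (suc (suc (suc (suc (suc zero))))) = refl

mirror-injective : ∀ {i j} → mirror i ≡ mirror j → i ≡ j
mirror-injective {i} {j} eq =
  trans (sym (mirror-involutive i)) (trans (cong mirror eq) (mirror-involutive j))

D-ᵒᵖ : ∀ i A → D i (A ᵒᵖ) ⇔ D (mirror i) A
D-ᵒᵖ zero                               A = mk⇔ (λ h x y z → h z x y) (λ h x y z → h y z x)
D-ᵒᵖ (suc zero)                         A = mk⇔ (λ h x y z → h y z x) (λ h x y z → h z x y)
D-ᵒᵖ (suc (suc zero))                   A = mk⇔ (λ h x y z → h z x y) (λ h x y z → h y z x)
D-ᵒᵖ (suc (suc (suc zero)))             A = mk⇔ (λ h x y z → h y z x) (λ h x y z → h z x y)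
D-ᵒᵖ (suc (suc (suc (suc zero))))       A = mk⇔ (λ h x y z → h y z x) (λ h x y z → h z x y)
D-ᵒᵖ (suc (suc (suc (suc (suc zero))))) A = mk⇔ (λ h x y z → h z x y) (λ h x y z → h y z x)

independenceWitness-ᵒᵖ : ∀ {i A} → IndependenceWitness (mirror i) A → IndependenceWitness i (A ᵒᵖ)
independenceWitness-ᵒᵖ {i} {A} (holds , fails) =
  (λ j j≢i → from (D-ᵒᵖ j A) (holds (mirror j) (j≢i ∘ mirror-injective)))
  , fails ∘ to (D-ᵒᵖ i A)
  where open Equivalence

record Searchable (C : Set) : Set₁ where
  infix 4 _≟_
  field
    _≟_ : DecidableEquality C
    ∀?  : {P : C → Set} → Decidable P → Dec (∀ x → P x)

  ∀₃? : {P : C → C → C → Set} → (∀ x y z → Dec (P x y z)) → Dec (∀ x y z → P x y z)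
  ∀₃? P? = ∀? λ x → ∀? λ y → ∀? λ z → P? x y z

Fin-searchable : ∀ {n} → Searchable (Fin n)
Fin-searchable = record { _≟_ = Fin._≟_ ; ∀? = Fin.all? }

_⇔?_ : ∀ {a b} {A : Set a} {B : Set b} → Dec A → Dec B → Dec (A ⇔ B)
a? ⇔? b? = map′ (λ (f , g) → mk⇔ f g) (λ e → Equivalence.to e , Equivalence.from e)
                ((a? →-dec b?) ×-dec (b? →-dec a?))

module _ {C : Set} (S : Searchable C) where
  open Searchable S

  isLattice? : (_∨_ _∧_ : Op₂ C) → Dec (IsLattice _≡_ _∨_ _∧_)
  isLattice? _∨_ _∧_ =
    map′ (λ (∨-comm , ∨-assoc , ∧-comm , ∧-assoc , absorptive) → record
           { isEquivalence = isEquivalence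
           ; ∨-comm = ∨-comm ; ∨-assoc = ∨-assoc ; ∨-cong = cong₂ _∨_
           ; ∧-comm = ∧-comm ; ∧-assoc = ∧-assoc ; ∧-cong = cong₂ _∧_
           ; absorptive = absorptive
           })
         (λ L → let open IsLattice L in ∨-comm , ∨-assoc , ∧-comm , ∧-assoc , absorptive)
         (   (∀? λ x → ∀? λ y → (x ∨ y) ≟ (y ∨ x))
       ×-dec ∀₃? (λ x y z → ((x ∨ y) ∨ z) ≟ (x ∨ (y ∨ z)))
       ×-dec (∀? λ x → ∀? λ y → (x ∧ y) ≟ (y ∧ x))
       ×-dec ∀₃? (λ x y z → ((x ∧ y) ∧ z) ≟ (x ∧ (y ∧ z)))
       ×-dec (∀? λ x → ∀? λ y → (x ∨ (x ∧ y)) ≟ x)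
       ×-dec (∀? λ x → ∀? λ y → (x ∧ (x ∨ y)) ≟ x))

  residuatedˡ? : (_∧_ _·_ _\\_ : Op₂ C) →
                 Dec (∀ x y z → ((x · y) ∧ z ≡ x · y) ⇔ (y ∧ (x \\ z) ≡ y))
  residuatedˡ? _∧_ _·_ _\\_ = ∀₃? λ x y z → (((x · y) ∧ z) ≟ (x · y)) ⇔? ((y ∧ (x \\ z)) ≟ y)

  residuatedʳ? : (_∧_ _·_ _//_ : Op₂ C) →
                 Dec (∀ x y z → ((x · y) ∧ z ≡ x · y) ⇔ (x ∧ (z // y) ≡ x))
  residuatedʳ? _∧_ _·_ _//_ = ∀₃? λ x y z → (((x · y) ∧ z) ≟ (x · y)) ⇔? ((x ∧ (z // y)) ≟ x)

module _ (A : ResiduatedBinar) (S : Searchable (ResiduatedBinar.Carrier A)) where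
  open Searchable S

  D? : ∀ i → Dec (D i A)
  D? zero                               = ∀₃? λ _ _ _ → _ ≟ _
  D? (suc zero)                         = ∀₃? λ _ _ _ → _ ≟ _
  D? (suc (suc zero))                   = ∀₃? λ _ _ _ → _ ≟ _
  D? (suc (suc (suc zero)))             = ∀₃? λ _ _ _ → _ ≟ _
  D? (suc (suc (suc (suc zero))))       = ∀₃? λ _ _ _ → _ ≟ _
  D? (suc (suc (suc (suc (suc zero))))) = ∀₃? λ _ _ _ → _ ≟ _

  independenceWitness? : ∀ i → Dec (IndependenceWitness i A)
  independenceWitness? i = Fin.all? (λ j → ¬? (j Fin.≟ i) →-dec D? j) ×-dec ¬? (D? i)

Table : ℕ → Set
Table n = Vec (Vec (Fin n) n) n

module _ {n : ℕ} where

  table : Table n → Op₂ (Fin n)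
  table t x y = lookup (lookup t x) y

  tabulated : (_∧_ _∨_ _·_ _\\_ _//_ : Op₂ (Fin n)) →
              {True (isLattice? Fin-searchable _∨_ _∧_)} →
              {True (residuatedˡ? Fin-searchable _∧_ _·_ _\\_)} →
              {True (residuatedʳ? Fin-searchable _∧_ _·_ _//_)} →
              ResiduatedBinar
  tabulated _∧_ _∨_ _·_ _\\_ _//_ {lattice} {resˡ} {resʳ} = record
    { Carrier = Fin n ; _∧_ = _∧_ ; _∨_ = _∨_ ; _·_ = _·_ ; _\\_ = _\\_ ; _//_ = _//_
    ; isLattice = toWitness lattice ; resˡ = toWitness resˡ ; resʳ = toWitness resʳ
    }

M₁ : ResiduatedBinar
M₁ = tabulated (table meet) (table join) (table mul) (table under) (table over)
  where
    meet join mul under over : Table 7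
    meet =
      ( (0 ∷ 0 ∷ 0 ∷ 0 ∷ 0 ∷ 0 ∷ 0 ∷ [])
      ∷ (0 ∷ 1 ∷ 1 ∷ 0 ∷ 1 ∷ 1 ∷ 1 ∷ [])
      ∷ (0 ∷ 1 ∷ 2 ∷ 0 ∷ 2 ∷ 2 ∷ 2 ∷ [])
      ∷ (0 ∷ 0 ∷ 0 ∷ 3 ∷ 3 ∷ 0 ∷ 3 ∷ [])
      ∷ (0 ∷ 1 ∷ 2 ∷ 3 ∷ 4 ∷ 2 ∷ 4 ∷ [])
      ∷ (0 ∷ 1 ∷ 2 ∷ 0 ∷ 2 ∷ 5 ∷ 5 ∷ [])
      ∷ (0 ∷ 1 ∷ 2 ∷ 3 ∷ 4 ∷ 5 ∷ 6 ∷ [])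
      ∷ [])
    join =
      ( (0 ∷ 1 ∷ 2 ∷ 3 ∷ 4 ∷ 5 ∷ 6 ∷ [])
      ∷ (1 ∷ 1 ∷ 2 ∷ 4 ∷ 4 ∷ 5 ∷ 6 ∷ [])
      ∷ (2 ∷ 2 ∷ 2 ∷ 4 ∷ 4 ∷ 5 ∷ 6 ∷ [])
      ∷ (3 ∷ 4 ∷ 4 ∷ 3 ∷ 4 ∷ 6 ∷ 6 ∷ [])
      ∷ (4 ∷ 4 ∷ 4 ∷ 4 ∷ 4 ∷ 6 ∷ 6 ∷ [])
      ∷ (5 ∷ 5 ∷ 5 ∷ 6 ∷ 6 ∷ 5 ∷ 6 ∷ [])
      ∷ (6 ∷ 6 ∷ 6 ∷ 6 ∷ 6 ∷ 6 ∷ 6 ∷ [])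
      ∷ [])
    mul =
      ( (0 ∷ 0 ∷ 0 ∷ 0 ∷ 0 ∷ 0 ∷ 0 ∷ [])
      ∷ (0 ∷ 1 ∷ 1 ∷ 0 ∷ 1 ∷ 5 ∷ 5 ∷ [])
      ∷ (0 ∷ 1 ∷ 1 ∷ 0 ∷ 1 ∷ 5 ∷ 5 ∷ [])
      ∷ (0 ∷ 0 ∷ 0 ∷ 3 ∷ 3 ∷ 0 ∷ 3 ∷ [])
      ∷ (0 ∷ 1 ∷ 1 ∷ 3 ∷ 4 ∷ 5 ∷ 6 ∷ [])
      ∷ (0 ∷ 1 ∷ 1 ∷ 0 ∷ 1 ∷ 5 ∷ 5 ∷ [])
      ∷ (0 ∷ 1 ∷ 1 ∷ 3 ∷ 4 ∷ 5 ∷ 6 ∷ [])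
      ∷ [])
    under =
      ( (6 ∷ 6 ∷ 6 ∷ 6 ∷ 6 ∷ 6 ∷ 6 ∷ [])
      ∷ (3 ∷ 4 ∷ 4 ∷ 3 ∷ 4 ∷ 6 ∷ 6 ∷ [])
      ∷ (3 ∷ 4 ∷ 4 ∷ 3 ∷ 4 ∷ 6 ∷ 6 ∷ [])
      ∷ (5 ∷ 5 ∷ 5 ∷ 6 ∷ 6 ∷ 5 ∷ 6 ∷ [])
      ∷ (0 ∷ 2 ∷ 2 ∷ 3 ∷ 4 ∷ 5 ∷ 6 ∷ [])
      ∷ (3 ∷ 4 ∷ 4 ∷ 3 ∷ 4 ∷ 6 ∷ 6 ∷ [])
      ∷ (0 ∷ 2 ∷ 2 ∷ 3 ∷ 4 ∷ 5 ∷ 6 ∷ [])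
      ∷ [])
    over =
      ( (6 ∷ 3 ∷ 3 ∷ 5 ∷ 0 ∷ 3 ∷ 0 ∷ [])
      ∷ (6 ∷ 6 ∷ 6 ∷ 5 ∷ 5 ∷ 3 ∷ 0 ∷ [])
      ∷ (6 ∷ 6 ∷ 6 ∷ 5 ∷ 5 ∷ 3 ∷ 0 ∷ [])
      ∷ (6 ∷ 3 ∷ 3 ∷ 6 ∷ 3 ∷ 3 ∷ 3 ∷ [])
      ∷ (6 ∷ 6 ∷ 6 ∷ 6 ∷ 6 ∷ 3 ∷ 3 ∷ [])
      ∷ (6 ∷ 6 ∷ 6 ∷ 5 ∷ 5 ∷ 6 ∷ 5 ∷ [])
      ∷ (6 ∷ 6 ∷ 6 ∷ 6 ∷ 6 ∷ 6 ∷ 6 ∷ [])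
      ∷ [])

M₃ : ResiduatedBinar
M₃ = tabulated (table meet) (table join) (table mul) (table under) (table over)
  where
    meet join mul under over : Table 7
    meet =
      ( (0 ∷ 0 ∷ 0 ∷ 0 ∷ 0 ∷ 0 ∷ 0 ∷ [])
      ∷ (0 ∷ 1 ∷ 0 ∷ 1 ∷ 1 ∷ 1 ∷ 1 ∷ [])
      ∷ (0 ∷ 0 ∷ 2 ∷ 2 ∷ 2 ∷ 0 ∷ 2 ∷ [])
      ∷ (0 ∷ 1 ∷ 2 ∷ 3 ∷ 3 ∷ 1 ∷ 3 ∷ [])
      ∷ (0 ∷ 1 ∷ 2 ∷ 3 ∷ 4 ∷ 1 ∷ 4 ∷ [])
      ∷ (0 ∷ 1 ∷ 0 ∷ 1 ∷ 1 ∷ 5 ∷ 5 ∷ [])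
      ∷ (0 ∷ 1 ∷ 2 ∷ 3 ∷ 4 ∷ 5 ∷ 6 ∷ [])
      ∷ [])
    join =
      ( (0 ∷ 1 ∷ 2 ∷ 3 ∷ 4 ∷ 5 ∷ 6 ∷ [])
      ∷ (1 ∷ 1 ∷ 3 ∷ 3 ∷ 4 ∷ 5 ∷ 6 ∷ [])
      ∷ (2 ∷ 3 ∷ 2 ∷ 3 ∷ 4 ∷ 6 ∷ 6 ∷ [])
      ∷ (3 ∷ 3 ∷ 3 ∷ 3 ∷ 4 ∷ 6 ∷ 6 ∷ [])
      ∷ (4 ∷ 4 ∷ 4 ∷ 4 ∷ 4 ∷ 6 ∷ 6 ∷ [])
      ∷ (5 ∷ 5 ∷ 6 ∷ 6 ∷ 6 ∷ 5 ∷ 6 ∷ [])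
      ∷ (6 ∷ 6 ∷ 6 ∷ 6 ∷ 6 ∷ 6 ∷ 6 ∷ [])
      ∷ [])
    mul =
      ( (0 ∷ 0 ∷ 0 ∷ 0 ∷ 0 ∷ 0 ∷ 0 ∷ [])
      ∷ (0 ∷ 1 ∷ 0 ∷ 1 ∷ 1 ∷ 5 ∷ 5 ∷ [])
      ∷ (0 ∷ 0 ∷ 2 ∷ 2 ∷ 2 ∷ 0 ∷ 2 ∷ [])
      ∷ (0 ∷ 1 ∷ 2 ∷ 3 ∷ 3 ∷ 5 ∷ 6 ∷ [])
      ∷ (0 ∷ 1 ∷ 2 ∷ 3 ∷ 3 ∷ 5 ∷ 6 ∷ [])
      ∷ (0 ∷ 1 ∷ 0 ∷ 1 ∷ 1 ∷ 5 ∷ 5 ∷ [])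
      ∷ (0 ∷ 1 ∷ 2 ∷ 3 ∷ 3 ∷ 5 ∷ 6 ∷ [])
      ∷ [])
    under =
      ( (6 ∷ 6 ∷ 6 ∷ 6 ∷ 6 ∷ 6 ∷ 6 ∷ [])
      ∷ (2 ∷ 4 ∷ 2 ∷ 4 ∷ 4 ∷ 6 ∷ 6 ∷ [])
      ∷ (5 ∷ 5 ∷ 6 ∷ 6 ∷ 6 ∷ 5 ∷ 6 ∷ [])
      ∷ (0 ∷ 1 ∷ 2 ∷ 4 ∷ 4 ∷ 5 ∷ 6 ∷ [])
      ∷ (0 ∷ 1 ∷ 2 ∷ 4 ∷ 4 ∷ 5 ∷ 6 ∷ [])
      ∷ (2 ∷ 4 ∷ 2 ∷ 4 ∷ 4 ∷ 6 ∷ 6 ∷ [])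
      ∷ (0 ∷ 1 ∷ 2 ∷ 4 ∷ 4 ∷ 5 ∷ 6 ∷ [])
      ∷ [])
    over =
      ( (6 ∷ 2 ∷ 5 ∷ 0 ∷ 0 ∷ 2 ∷ 0 ∷ [])
      ∷ (6 ∷ 6 ∷ 5 ∷ 5 ∷ 5 ∷ 2 ∷ 0 ∷ [])
      ∷ (6 ∷ 2 ∷ 6 ∷ 2 ∷ 2 ∷ 2 ∷ 2 ∷ [])
      ∷ (6 ∷ 6 ∷ 6 ∷ 6 ∷ 6 ∷ 2 ∷ 2 ∷ [])
      ∷ (6 ∷ 6 ∷ 6 ∷ 6 ∷ 6 ∷ 2 ∷ 2 ∷ [])
      ∷ (6 ∷ 6 ∷ 5 ∷ 5 ∷ 5 ∷ 6 ∷ 5 ∷ [])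
      ∷ (6 ∷ 6 ∷ 6 ∷ 6 ∷ 6 ∷ 6 ∷ 6 ∷ [])
      ∷ [])

M₅ : ResiduatedBinar
M₅ = tabulated (table meet) (table join) (table mul) (table under) (table over)
  where
    meet join mul under over : Table 14
    meet =
      ( ( 0 ∷  0 ∷  0 ∷  0 ∷  0 ∷  0 ∷  0 ∷  0 ∷  0 ∷  0 ∷  0 ∷  0 ∷  0 ∷  0 ∷ [])
      ∷ ( 0 ∷  1 ∷  0 ∷  0 ∷  1 ∷  1 ∷  0 ∷  0 ∷  1 ∷  1 ∷  0 ∷  1 ∷  0 ∷  1 ∷ [])
      ∷ ( 0 ∷  0 ∷  2 ∷  0 ∷  2 ∷  0 ∷  2 ∷  2 ∷  2 ∷  2 ∷  2 ∷  2 ∷  2 ∷  2 ∷ [])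
      ∷ ( 0 ∷  0 ∷  0 ∷  3 ∷  0 ∷  3 ∷  0 ∷  3 ∷  0 ∷  3 ∷  3 ∷  3 ∷  3 ∷  3 ∷ [])
      ∷ ( 0 ∷  1 ∷  2 ∷  0 ∷  4 ∷  1 ∷  2 ∷  2 ∷  4 ∷  4 ∷  2 ∷  4 ∷  2 ∷  4 ∷ [])
      ∷ ( 0 ∷  1 ∷  0 ∷  3 ∷  1 ∷  5 ∷  0 ∷  3 ∷  1 ∷  5 ∷  3 ∷  5 ∷  3 ∷  5 ∷ [])
      ∷ ( 0 ∷  0 ∷  2 ∷  0 ∷  2 ∷  0 ∷  6 ∷  2 ∷  6 ∷  2 ∷  2 ∷  2 ∷  6 ∷  6 ∷ [])
      ∷ ( 0 ∷  0 ∷  2 ∷  3 ∷  2 ∷  3 ∷  2 ∷  7 ∷  2 ∷  7 ∷  7 ∷  7 ∷  7 ∷  7 ∷ [])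
      ∷ ( 0 ∷  1 ∷  2 ∷  0 ∷  4 ∷  1 ∷  6 ∷  2 ∷  8 ∷  4 ∷  2 ∷  4 ∷  6 ∷  8 ∷ [])
      ∷ ( 0 ∷  1 ∷  2 ∷  3 ∷  4 ∷  5 ∷  2 ∷  7 ∷  4 ∷  9 ∷  7 ∷  9 ∷  7 ∷  9 ∷ [])
      ∷ ( 0 ∷  0 ∷  2 ∷  3 ∷  2 ∷  3 ∷  2 ∷  7 ∷  2 ∷  7 ∷ 10 ∷ 10 ∷ 10 ∷ 10 ∷ [])
      ∷ ( 0 ∷  1 ∷  2 ∷  3 ∷  4 ∷  5 ∷  2 ∷  7 ∷  4 ∷  9 ∷ 10 ∷ 11 ∷ 10 ∷ 11 ∷ [])
      ∷ ( 0 ∷  0 ∷  2 ∷  3 ∷  2 ∷  3 ∷  6 ∷  7 ∷  6 ∷  7 ∷ 10 ∷ 10 ∷ 12 ∷ 12 ∷ [])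
      ∷ ( 0 ∷  1 ∷  2 ∷  3 ∷  4 ∷  5 ∷  6 ∷  7 ∷  8 ∷  9 ∷ 10 ∷ 11 ∷ 12 ∷ 13 ∷ [])
      ∷ [])
    join =
      ( ( 0 ∷  1 ∷  2 ∷  3 ∷  4 ∷  5 ∷  6 ∷  7 ∷  8 ∷  9 ∷ 10 ∷ 11 ∷ 12 ∷ 13 ∷ [])
      ∷ ( 1 ∷  1 ∷  4 ∷  5 ∷  4 ∷  5 ∷  8 ∷  9 ∷  8 ∷  9 ∷ 11 ∷ 11 ∷ 13 ∷ 13 ∷ [])
      ∷ ( 2 ∷  4 ∷  2 ∷  7 ∷  4 ∷  9 ∷  6 ∷  7 ∷  8 ∷  9 ∷ 10 ∷ 11 ∷ 12 ∷ 13 ∷ [])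
      ∷ ( 3 ∷  5 ∷  7 ∷  3 ∷  9 ∷  5 ∷ 12 ∷  7 ∷ 13 ∷  9 ∷ 10 ∷ 11 ∷ 12 ∷ 13 ∷ [])
      ∷ ( 4 ∷  4 ∷  4 ∷  9 ∷  4 ∷  9 ∷  8 ∷  9 ∷  8 ∷  9 ∷ 11 ∷ 11 ∷ 13 ∷ 13 ∷ [])
      ∷ ( 5 ∷  5 ∷  9 ∷  5 ∷  9 ∷  5 ∷ 13 ∷  9 ∷ 13 ∷  9 ∷ 11 ∷ 11 ∷ 13 ∷ 13 ∷ [])
      ∷ ( 6 ∷  8 ∷  6 ∷ 12 ∷  8 ∷ 13 ∷  6 ∷ 12 ∷  8 ∷ 13 ∷ 12 ∷ 13 ∷ 12 ∷ 13 ∷ [])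
      ∷ ( 7 ∷  9 ∷  7 ∷  7 ∷  9 ∷  9 ∷ 12 ∷  7 ∷ 13 ∷  9 ∷ 10 ∷ 11 ∷ 12 ∷ 13 ∷ [])
      ∷ ( 8 ∷  8 ∷  8 ∷ 13 ∷  8 ∷ 13 ∷  8 ∷ 13 ∷  8 ∷ 13 ∷ 13 ∷ 13 ∷ 13 ∷ 13 ∷ [])
      ∷ ( 9 ∷  9 ∷  9 ∷  9 ∷  9 ∷  9 ∷ 13 ∷  9 ∷ 13 ∷  9 ∷ 11 ∷ 11 ∷ 13 ∷ 13 ∷ [])
      ∷ (10 ∷ 11 ∷ 10 ∷ 10 ∷ 11 ∷ 11 ∷ 12 ∷ 10 ∷ 13 ∷ 11 ∷ 10 ∷ 11 ∷ 12 ∷ 13 ∷ [])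
      ∷ (11 ∷ 11 ∷ 11 ∷ 11 ∷ 11 ∷ 11 ∷ 13 ∷ 11 ∷ 13 ∷ 11 ∷ 11 ∷ 11 ∷ 13 ∷ 13 ∷ [])
      ∷ (12 ∷ 13 ∷ 12 ∷ 12 ∷ 13 ∷ 13 ∷ 12 ∷ 12 ∷ 13 ∷ 13 ∷ 12 ∷ 13 ∷ 12 ∷ 13 ∷ [])
      ∷ (13 ∷ 13 ∷ 13 ∷ 13 ∷ 13 ∷ 13 ∷ 13 ∷ 13 ∷ 13 ∷ 13 ∷ 13 ∷ 13 ∷ 13 ∷ 13 ∷ [])
      ∷ [])
    mul =
      ( ( 0 ∷  0 ∷  0 ∷  0 ∷  0 ∷  0 ∷  0 ∷  0 ∷  0 ∷  0 ∷  0 ∷  0 ∷  0 ∷  0 ∷ [])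
      ∷ ( 0 ∷  0 ∷  0 ∷  1 ∷  0 ∷  1 ∷  0 ∷  1 ∷  0 ∷  1 ∷  1 ∷  1 ∷  1 ∷  1 ∷ [])
      ∷ ( 0 ∷  0 ∷  0 ∷  0 ∷  0 ∷  0 ∷  2 ∷  0 ∷  2 ∷  0 ∷  0 ∷  0 ∷  2 ∷  2 ∷ [])
      ∷ ( 0 ∷  0 ∷  0 ∷  0 ∷  0 ∷  0 ∷  0 ∷  0 ∷  0 ∷  0 ∷  0 ∷  0 ∷  0 ∷  0 ∷ [])
      ∷ ( 0 ∷  0 ∷  0 ∷  1 ∷  0 ∷  1 ∷  2 ∷  1 ∷  2 ∷  1 ∷  1 ∷  1 ∷  4 ∷  4 ∷ [])
      ∷ ( 0 ∷  0 ∷  0 ∷  1 ∷  0 ∷  1 ∷  0 ∷  1 ∷  0 ∷  1 ∷  1 ∷  1 ∷  1 ∷  1 ∷ [])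
      ∷ ( 0 ∷  0 ∷  2 ∷  0 ∷  2 ∷  0 ∷  2 ∷  2 ∷  2 ∷  2 ∷  2 ∷  2 ∷  2 ∷  2 ∷ [])
      ∷ ( 0 ∷  0 ∷  0 ∷  0 ∷  0 ∷  0 ∷  2 ∷  0 ∷  2 ∷  0 ∷  0 ∷  0 ∷  2 ∷  2 ∷ [])
      ∷ ( 0 ∷  0 ∷  2 ∷  1 ∷  2 ∷  1 ∷  2 ∷  4 ∷  2 ∷  4 ∷  4 ∷  4 ∷  4 ∷  4 ∷ [])
      ∷ ( 0 ∷  0 ∷  0 ∷  1 ∷  0 ∷  1 ∷  2 ∷  1 ∷  2 ∷  1 ∷  1 ∷  1 ∷  4 ∷  4 ∷ [])
      ∷ ( 0 ∷  0 ∷  0 ∷  0 ∷  0 ∷  0 ∷  2 ∷  0 ∷  2 ∷  0 ∷  0 ∷  0 ∷  2 ∷  2 ∷ [])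
      ∷ ( 0 ∷  0 ∷  0 ∷  1 ∷  0 ∷  1 ∷  2 ∷  1 ∷  2 ∷  1 ∷  1 ∷  1 ∷  4 ∷  4 ∷ [])
      ∷ ( 0 ∷  0 ∷  2 ∷  0 ∷  2 ∷  0 ∷  2 ∷  2 ∷  2 ∷  2 ∷  2 ∷  2 ∷  2 ∷  2 ∷ [])
      ∷ ( 0 ∷  0 ∷  2 ∷  1 ∷  2 ∷  1 ∷  2 ∷  4 ∷  2 ∷  4 ∷  4 ∷  4 ∷  4 ∷  4 ∷ [])
      ∷ [])
    under =
      ( (13 ∷ 13 ∷ 13 ∷ 13 ∷ 13 ∷ 13 ∷ 13 ∷ 13 ∷ 13 ∷ 13 ∷ 13 ∷ 13 ∷ 13 ∷ 13 ∷ [])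
      ∷ ( 8 ∷ 13 ∷  8 ∷  8 ∷ 13 ∷ 13 ∷  8 ∷  8 ∷ 13 ∷ 13 ∷  8 ∷ 13 ∷  8 ∷ 13 ∷ [])
      ∷ (11 ∷ 11 ∷ 13 ∷ 11 ∷ 13 ∷ 11 ∷ 13 ∷ 13 ∷ 13 ∷ 13 ∷ 13 ∷ 13 ∷ 13 ∷ 13 ∷ [])
      ∷ (13 ∷ 13 ∷ 13 ∷ 13 ∷ 13 ∷ 13 ∷ 13 ∷ 13 ∷ 13 ∷ 13 ∷ 13 ∷ 13 ∷ 13 ∷ 13 ∷ [])
      ∷ ( 4 ∷ 11 ∷  8 ∷  4 ∷ 13 ∷ 11 ∷  8 ∷  8 ∷ 13 ∷ 13 ∷  8 ∷ 13 ∷  8 ∷ 13 ∷ [])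
      ∷ ( 8 ∷ 13 ∷  8 ∷  8 ∷ 13 ∷ 13 ∷  8 ∷  8 ∷ 13 ∷ 13 ∷  8 ∷ 13 ∷  8 ∷ 13 ∷ [])
      ∷ ( 5 ∷  5 ∷ 13 ∷  5 ∷ 13 ∷  5 ∷ 13 ∷ 13 ∷ 13 ∷ 13 ∷ 13 ∷ 13 ∷ 13 ∷ 13 ∷ [])
      ∷ (11 ∷ 11 ∷ 13 ∷ 11 ∷ 13 ∷ 11 ∷ 13 ∷ 13 ∷ 13 ∷ 13 ∷ 13 ∷ 13 ∷ 13 ∷ 13 ∷ [])
      ∷ ( 1 ∷  5 ∷  8 ∷  1 ∷ 13 ∷  5 ∷  8 ∷  8 ∷ 13 ∷ 13 ∷  8 ∷ 13 ∷  8 ∷ 13 ∷ [])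
      ∷ ( 4 ∷ 11 ∷  8 ∷  4 ∷ 13 ∷ 11 ∷  8 ∷  8 ∷ 13 ∷ 13 ∷  8 ∷ 13 ∷  8 ∷ 13 ∷ [])
      ∷ (11 ∷ 11 ∷ 13 ∷ 11 ∷ 13 ∷ 11 ∷ 13 ∷ 13 ∷ 13 ∷ 13 ∷ 13 ∷ 13 ∷ 13 ∷ 13 ∷ [])
      ∷ ( 4 ∷ 11 ∷  8 ∷  4 ∷ 13 ∷ 11 ∷  8 ∷  8 ∷ 13 ∷ 13 ∷  8 ∷ 13 ∷  8 ∷ 13 ∷ [])
      ∷ ( 5 ∷  5 ∷ 13 ∷  5 ∷ 13 ∷  5 ∷ 13 ∷ 13 ∷ 13 ∷ 13 ∷ 13 ∷ 13 ∷ 13 ∷ 13 ∷ [])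
      ∷ ( 1 ∷  5 ∷  8 ∷  1 ∷ 13 ∷  5 ∷  8 ∷  8 ∷ 13 ∷ 13 ∷  8 ∷ 13 ∷  8 ∷ 13 ∷ [])
      ∷ [])
    over =
      ( (13 ∷ 13 ∷ 11 ∷ 12 ∷ 11 ∷ 12 ∷  5 ∷ 10 ∷  5 ∷ 10 ∷ 10 ∷ 10 ∷  3 ∷  3 ∷ [])
      ∷ (13 ∷ 13 ∷ 11 ∷ 13 ∷ 11 ∷ 13 ∷  5 ∷ 11 ∷  5 ∷ 11 ∷ 11 ∷ 11 ∷  5 ∷  5 ∷ [])
      ∷ (13 ∷ 13 ∷ 13 ∷ 12 ∷ 13 ∷ 12 ∷ 13 ∷ 12 ∷ 13 ∷ 12 ∷ 12 ∷ 12 ∷ 12 ∷ 12 ∷ [])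
      ∷ (13 ∷ 13 ∷ 11 ∷ 12 ∷ 11 ∷ 12 ∷  5 ∷ 10 ∷  5 ∷ 10 ∷ 10 ∷ 10 ∷  3 ∷  3 ∷ [])
      ∷ (13 ∷ 13 ∷ 13 ∷ 13 ∷ 13 ∷ 13 ∷ 13 ∷ 13 ∷ 13 ∷ 13 ∷ 13 ∷ 13 ∷ 13 ∷ 13 ∷ [])
      ∷ (13 ∷ 13 ∷ 11 ∷ 13 ∷ 11 ∷ 13 ∷  5 ∷ 11 ∷  5 ∷ 11 ∷ 11 ∷ 11 ∷  5 ∷  5 ∷ [])
      ∷ (13 ∷ 13 ∷ 13 ∷ 12 ∷ 13 ∷ 12 ∷ 13 ∷ 12 ∷ 13 ∷ 12 ∷ 12 ∷ 12 ∷ 12 ∷ 12 ∷ [])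
      ∷ (13 ∷ 13 ∷ 13 ∷ 12 ∷ 13 ∷ 12 ∷ 13 ∷ 12 ∷ 13 ∷ 12 ∷ 12 ∷ 12 ∷ 12 ∷ 12 ∷ [])
      ∷ (13 ∷ 13 ∷ 13 ∷ 13 ∷ 13 ∷ 13 ∷ 13 ∷ 13 ∷ 13 ∷ 13 ∷ 13 ∷ 13 ∷ 13 ∷ 13 ∷ [])
      ∷ (13 ∷ 13 ∷ 13 ∷ 13 ∷ 13 ∷ 13 ∷ 13 ∷ 13 ∷ 13 ∷ 13 ∷ 13 ∷ 13 ∷ 13 ∷ 13 ∷ [])
      ∷ (13 ∷ 13 ∷ 13 ∷ 12 ∷ 13 ∷ 12 ∷ 13 ∷ 12 ∷ 13 ∷ 12 ∷ 12 ∷ 12 ∷ 12 ∷ 12 ∷ [])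
      ∷ (13 ∷ 13 ∷ 13 ∷ 13 ∷ 13 ∷ 13 ∷ 13 ∷ 13 ∷ 13 ∷ 13 ∷ 13 ∷ 13 ∷ 13 ∷ 13 ∷ [])
      ∷ (13 ∷ 13 ∷ 13 ∷ 12 ∷ 13 ∷ 12 ∷ 13 ∷ 12 ∷ 13 ∷ 12 ∷ 12 ∷ 12 ∷ 12 ∷ 12 ∷ [])
      ∷ (13 ∷ 13 ∷ 13 ∷ 13 ∷ 13 ∷ 13 ∷ 13 ∷ 13 ∷ 13 ∷ 13 ∷ 13 ∷ 13 ∷ 13 ∷ 13 ∷ [])
      ∷ [])

M₁-witnesses-D1 : IndependenceWitness 0 M₁
M₁-witnesses-D1 = from-yes (independenceWitness? M₁ Fin-searchable 0)

M₃-witnesses-D3 : IndependenceWitness 2 M₃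
M₃-witnesses-D3 = from-yes (independenceWitness? M₃ Fin-searchable 2)

M₅-witnesses-D5 : IndependenceWitness 4 M₅
M₅-witnesses-D5 = from-yes (independenceWitness? M₅ Fin-searchable 4)

theorem2 : (i : Fin 6) → Σ ResiduatedBinar (λ A → ((j : Fin 6) → ¬ (j ≡ i) → D j A) × ¬ D i A)
theorem2 zero                               = M₁ , M₁-witnesses-D1
theorem2 (suc zero)                         = M₁ ᵒᵖ , independenceWitness-ᵒᵖ M₁-witnesses-D1
theorem2 (suc (suc zero))                   = M₃ , M₃-witnesses-D3
theorem2 (suc (suc (suc zero)))             = M₃ ᵒᵖ , independenceWitness-ᵒᵖ M₃-witnesses-D3
theorem2 (suc (suc (suc (suc zero))))       = M₅ , M₅-witnesses-D5
theorem2 (suc (suc (suc (suc (suc zero))))) = M₅ ᵒᵖ , independenceWitness-ᵒᵖ M₅-witnesses-D5
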